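{- For an integer $h\geq 1$ let $\Gamma_{2^h}$ denote the multiplicative circulant graph $MC(2^h)$, and let $\Gamma_{2^0}$ denote the one-vertex graph. Let $h$ be a positive integer. If $h=2n$, then $$d_{\Gamma_{2^h}}(0,j)=\begin{cases} d_{\Gamma_{2^{h-1}}}(0,j) & \text{if } j=0,1,2,\ldots,\tfrac{1}{3}(4^n-1),\\ d_{\Gamma_{2^{h-1}}}(0,j)+1 & \text{if } j=\tfrac{1}{3}(4^n-1)+1,\ldots,2^{h-1}.\end{cases}$$ If $h=2n+1$, then $$d_{\Gamma_{2^h}}(0,j)=\begin{cases} d_{\Gamma_{2^{h-1}}}(0,j) & \text{if } j=0,1,2,\ldots,\tfrac{2}{3}(4^n-1),\\ d_{\Gamma_{2^{h-1}}}(0,j)+1 & \text{if } j=\tfrac{2}{3}(4^n-1)+1,\ldots,2^{h-1}.\end{cases}$$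
   Context: For integers $m>1$, $h>0$, the multiplicative circulant graph $MC(m^h)$ is the graph with vertex set $\mathbb{Z}_{m^h}$ in which distinct vertices $x,y$ are adjacent if and only if $x-y\equiv \pm m^i \pmod{m^h}$ for some $i\in\{0,1,\ldots,h-1\}$ (i.e. the circulant graph $Cay(\mathbb{Z}_{m^h},\{m^0,m^1,\ldots,m^{h-1}\})$). $d_\Gamma(u,v)$ is the length of a shortest path between $u$ and $v$ in $\Gamma$. An integer $j$ used as a vertex of $\Gamma_{2^{k}}$ is identified with its residue modulo $2^{k}$ (so e.g. the vertex $2^{h-1}$ of $\Gamma_{2^{h-1}}$ is its vertex $0$). -}

module Defs where

open import Data.Nat using (ℕ; zero; suc; _+_; _*_; _^_; _<_; _≤_)
open import Data.Nat.DivMod using (_%_)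
open import Data.Nat.Properties using (m^n≢0)
open import Data.Product using (Σ; _×_)
open import Data.Sum using (_⊎_)
open import Relation.Binary.PropositionalEquality using (_≡_; _≢_)

-- Reduction of a natural number modulo 2^k (the vertex set of Γ_{2^k} is ℤ_{2^k};
-- an integer j used as a vertex is identified with j mod 2^k).
_mod2^_ : ℕ → ℕ → ℕ
x mod2^ k = _%_ x (2 ^ k) {{m^n≢0 2 k}}

-- Adjacency in Γ_{2^k} = MC(2^k) = Cay(ℤ_{2^k}, {2^0,...,2^{k-1}}):
-- distinct x, y with x - y ≡ ±2^i (mod 2^k) for some i < k.
-- For k = 0 there is no i < 0, so Γ_{2^0} is the one-vertex graph with no edges.
Adj : ℕ → ℕ → ℕ → Set
Adj k x y =
  (x mod2^ k ≢ y mod2^ k) ×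
  Σ ℕ (λ i → (i < k) ×
    (((y + 2 ^ i) mod2^ k ≡ x mod2^ k) ⊎ ((x + 2 ^ i) mod2^ k ≡ y mod2^ k)))

data Walk (k : ℕ) : ℕ → ℕ → ℕ → Set where
  here : ∀ {x y} → x mod2^ k ≡ y mod2^ k → Walk k x y zero
  step : ∀ {x z y n} → Adj k x z → Walk k z y n → Walk k x y (suc n)

Dist : ℕ → ℕ → ℕ → ℕ → Set
Dist k u v d = Walk k u v d × (∀ m → Walk k u v m → d ≤ m)

-- Define d_k by d_0 = 0, d_{k+1}(2m) = d_k(m) and d_{k+1}(2m+1) = 1 + min (d_k(m), d_k(m+1)).
-- Doubling a walk of Γ_{2^k} gives a walk of Γ_{2^{k+1}}, and one more edge of length 1
-- reaches the odd vertices, so d_k(j) is the length of some walk from 0 to j.  Conversely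
-- d_k is 2^k-periodic and changes by at most one along every edge ±2^i, so no walk is
-- shorter: d_k is the distance from 0.  Comparing the recursions at levels k + 1 and k,
-- the increment d_{k+1} − d_k on [0, 2^k] is 0 up to a threshold t_{k+1} and 1 beyond it,
-- with t_{k+1} = 2 t_k + [k odd]; the parity enters through the step of d_k just after
-- the threshold, d_k(t_{k+1}) − d_k(t_{k+1} + 1) = [k odd], which alternates with the
-- level.  Solving the recursion gives t_{2n} = (4^n − 1)/3 and t_{2n+1} = 2(4^n − 1)/3.
module Submission where

open import Defs
open import Data.Nat using (ℕ; zero; suc; _+_; _*_; _^_; _∸_; _<_; _≤_)
open import Data.Nat.Base using (_⊓_; z≤n; s≤s; s≤s⁻¹; ⌊_/2⌋; ⌈_/2⌉; parity)
open import Data.Nat.Properties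
open import Data.Nat.DivMod
  using (_/_; _%_; %-congˡ; %-congʳ; %-distribˡ-+; n%1≡0; m≡m%n+[m/n]*n; m*n/n≡m;
         m%n*o≡m*o%[n*o]; [m*n+o]%[p*n]≡[m*n]%[p*n]+o)
open import Data.Nat.Tactic.RingSolver using (solve-∀)
open import Data.Parity.Base using (Parity; 0ℙ; 1ℙ; _⁻¹)
open import Data.Parity.Properties using (suc-homo-⁻¹; ⁻¹-involutive; +-homo-+; p+p≡0ℙ; *-homo-*)
open import Data.Product using (_×_; _,_; proj₁; proj₂)
open import Data.Sum using (inj₁; inj₂) renaming (map to ⊎-map)
open import Function using (_∘_)
open import Relation.Binary.PropositionalEquality
  using (_≡_; _≢_; refl; sym; trans; cong; cong₂; subst; subst₂; module ≡-Reasoning)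

-- Parity and halving

parity-suc : ∀ n → parity (suc n) ≡ parity n ⁻¹
parity-suc n = trans (sym (⁻¹-involutive (parity (suc n)))) (cong _⁻¹ (suc-homo-⁻¹ n))

parity-double : ∀ m → parity (m + m) ≡ 0ℙ
parity-double m = trans (+-homo-+ m m) (p+p≡0ℙ (parity m))

parity-double+1 : ∀ m → parity (suc (m + m)) ≡ 1ℙ
parity-double+1 m = trans (parity-suc (m + m)) (cong _⁻¹ (parity-double m))

data Half : ℕ → Set where
  even : ∀ m → Half (m + m)
  odd  : ∀ m → Half (suc (m + m))

half : ∀ n → Half n
half zero = even 0
half (suc n) with half n
... | even m = odd m
... | odd m  = subst Half (cong suc (+-suc m m)) (even (suc m))

⌊n+n/2⌋≡n : ∀ n → ⌊ n + n /2⌋ ≡ n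
⌊n+n/2⌋≡n n = sym (n≡⌊n+n/2⌋ n)

⌊1+n+n/2⌋≡n : ∀ n → ⌊ suc (n + n) /2⌋ ≡ n
⌊1+n+n/2⌋≡n n = sym (n≡⌈n+n/2⌉ n)

half-≤ : ∀ {a b m n} → a ≤ b → ⌊ a /2⌋ ≡ m → ⌊ b /2⌋ ≡ n → m ≤ n
half-≤ a≤b p q = subst₂ _≤_ p q (⌊n/2⌋-mono a≤b)

m+m+2*n≡[m+n]+[m+n] : ∀ m n → m + m + 2 * n ≡ m + n + (m + n)
m+m+2*n≡[m+n]+[m+n] = solve-∀

m+m+q*[2*n]≡[m+q*n]+[m+q*n] : ∀ m q n → m + m + q * (2 * n) ≡ m + q * n + (m + q * n)
m+m+q*[2*n]≡[m+q*n]+[m+q*n] = solve-∀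

2^[1+k]≡2^k+2^k : ∀ k → 2 ^ suc k ≡ 2 ^ k + 2 ^ k
2^[1+k]≡2^k+2^k k = cong (2 ^ k +_) (+-identityʳ (2 ^ k))

n+n-injective : ∀ {m n} → m + m ≡ n + n → m ≡ n
n+n-injective {m} {n} eq = subst₂ _≡_ (⌊n+n/2⌋≡n m) (⌊n+n/2⌋≡n n) (cong ⌊_/2⌋ eq)

WithinOne : ℕ → ℕ → Set
WithinOne a b = a ≤ suc b × b ≤ suc a

withinOne-sym : ∀ {a b} → WithinOne a b → WithinOne b a
withinOne-sym (p , q) = q , p

withinOne-suc : ∀ {a b} → WithinOne a b → WithinOne (suc a) (suc b)
withinOne-suc (p , q) = s≤s p , s≤s q

withinOne-⊓ : ∀ {a b c d} → WithinOne a c → WithinOne b d → WithinOne (a ⊓ b) (c ⊓ d)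
withinOne-⊓ (p , q) (p′ , q′) = ⊓-mono-≤ p p′ , ⊓-mono-≤ q q′

withinOne-1+⊓ : ∀ {a b} → a ≤ suc b → WithinOne a (suc (a ⊓ b))
withinOne-1+⊓ {a} {b} a≤1+b = m≤n⇒m≤1+n (⊓-glb (n≤1+n a) a≤1+b) , s≤s (m⊓n≤m a b)

-- The recursive distance function

dist : ℕ → ℕ → ℕ
dist zero    j = 0
dist (suc k) j with parity j
... | 0ℙ = dist k ⌊ j /2⌋
... | 1ℙ = suc (dist k ⌊ j /2⌋ ⊓ dist k ⌈ j /2⌉)

dist-double : ∀ k m → dist (suc k) (m + m) ≡ dist k m
dist-double k m rewrite parity-double m = cong (dist k) (⌊n+n/2⌋≡n m)

dist-double+1 : ∀ k m → dist (suc k) (suc (m + m)) ≡ suc (dist k m ⊓ dist k (suc m))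
dist-double+1 k m rewrite parity-double+1 m =
  cong₂ (λ a b → suc (dist k a ⊓ dist k (suc b))) (⌊1+n+n/2⌋≡n m) (⌊n+n/2⌋≡n m)

dist-double+2 : ∀ k m → dist (suc k) (suc (suc (m + m))) ≡ dist k (suc m)
dist-double+2 k m = trans (cong (dist (suc k) ∘ suc) (sym (+-suc m m))) (dist-double k (suc m))

dist-zero : ∀ k → dist k 0 ≡ 0
dist-zero zero    = refl
dist-zero (suc k) = dist-zero k

dist-+-*2^ : ∀ k x q → dist k (x + q * 2 ^ k) ≡ dist k x
dist-+-*2^ zero    x q = refl
dist-+-*2^ (suc k) x q with half x
... | even m = begin
  dist (suc k) (m + m + q * 2 ^ suc k)           ≡⟨ cong (dist (suc k)) (m+m+q*[2*n]≡[m+q*n]+[m+q*n] m q (2 ^ k)) ⟩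
  dist (suc k) (m + q * 2 ^ k + (m + q * 2 ^ k)) ≡⟨ dist-double k _ ⟩
  dist k (m + q * 2 ^ k)                         ≡⟨ dist-+-*2^ k m q ⟩
  dist k m                                       ≡⟨ dist-double k m ⟨
  dist (suc k) (m + m)                           ∎
  where open ≡-Reasoning
... | odd m = begin
  dist (suc k) (suc (m + m + q * 2 ^ suc k))         ≡⟨ cong (dist (suc k) ∘ suc) (m+m+q*[2*n]≡[m+q*n]+[m+q*n] m q (2 ^ k)) ⟩
  dist (suc k) (suc (m + q * 2 ^ k + (m + q * 2 ^ k))) ≡⟨ dist-double+1 k _ ⟩
  suc (dist k (m + q * 2 ^ k) ⊓ dist k (suc m + q * 2 ^ k))
    ≡⟨ cong₂ (λ a b → suc (a ⊓ b)) (dist-+-*2^ k m q) (dist-+-*2^ k (suc m) q) ⟩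
  suc (dist k m ⊓ dist k (suc m))                     ≡⟨ dist-double+1 k m ⟨
  dist (suc k) (suc (m + m))                          ∎
  where open ≡-Reasoning

dist-mod : ∀ k x → dist k (x mod2^ k) ≡ dist k x
dist-mod k x = trans (sym (dist-+-*2^ k (x % 2 ^ k) (x / 2 ^ k)))
                     (cong (dist k) (sym (m≡m%n+[m/n]*n x (2 ^ k))))
  where instance _ = m^n≢0 2 k

dist-cong : ∀ k {x y} → x mod2^ k ≡ y mod2^ k → dist k x ≡ dist k y
dist-cong k {x} {y} eq = trans (sym (dist-mod k x)) (trans (cong (dist k) eq) (dist-mod k y))

dist-withinOne-suc : ∀ k y → WithinOne (dist k y) (dist k (suc y))
dist-withinOne-suc zero    y = z≤n , z≤n
dist-withinOne-suc (suc k) y with half y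
... | even m rewrite dist-double k m | dist-double+1 k m =
  withinOne-1+⊓ (proj₁ (dist-withinOne-suc k m))
... | odd m rewrite dist-double+1 k m | dist-double+2 k m =
  withinOne-sym (subst (WithinOne (dist k (suc m)) ∘ suc) (⊓-comm _ _)
                       (withinOne-1+⊓ (proj₂ (dist-withinOne-suc k m))))

dist-withinOne-+2^ : ∀ k i y → i < k → WithinOne (dist k y) (dist k (y + 2 ^ i))
dist-withinOne-+2^ (suc k) zero y _ =
  subst (WithinOne (dist (suc k) y) ∘ dist (suc k)) (+-comm 1 y) (dist-withinOne-suc (suc k) y)
dist-withinOne-+2^ (suc k) (suc i) y (s≤s i<k) with half y
... | even m rewrite m+m+2*n≡[m+n]+[m+n] m (2 ^ i) | dist-double k m | dist-double k (m + 2 ^ i) =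
  dist-withinOne-+2^ k i m i<k
... | odd m rewrite m+m+2*n≡[m+n]+[m+n] m (2 ^ i) | dist-double+1 k m | dist-double+1 k (m + 2 ^ i) =
  withinOne-suc (withinOne-⊓ (dist-withinOne-+2^ k i m i<k) (dist-withinOne-+2^ k i (suc m) i<k))

-- Walks in Γ_{2^k}

mod2^-+-congˡ : ∀ k {a b} c → a mod2^ k ≡ b mod2^ k → (a + c) mod2^ k ≡ (b + c) mod2^ k
mod2^-+-congˡ k {a} {b} c eq = begin
  (a + c) % 2 ^ k                 ≡⟨ %-distribˡ-+ a c (2 ^ k) ⟩
  (a % 2 ^ k + c % 2 ^ k) % 2 ^ k ≡⟨ cong (λ r → (r + c % 2 ^ k) % 2 ^ k) eq ⟩
  (b % 2 ^ k + c % 2 ^ k) % 2 ^ k ≡⟨ %-distribˡ-+ b c (2 ^ k) ⟨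
  (b + c) % 2 ^ k                 ∎
  where
  open ≡-Reasoning
  instance _ = m^n≢0 2 k

mod2^-double-+ : ∀ k x {r} → r < 2 → (r + (x + x)) mod2^ suc k ≡ r + (x mod2^ k + x mod2^ k)
mod2^-double-+ k x {r} r<2 = begin
  (r + (x + x)) % 2 ^ suc k          ≡⟨ %-congˡ (reorder r x) ⟩
  (x * 2 + r) % 2 ^ suc k            ≡⟨ %-congʳ (*-comm 2 (2 ^ k)) ⟩
  (x * 2 + r) % (2 ^ k * 2)          ≡⟨ [m*n+o]%[p*n]≡[m*n]%[p*n]+o x (2 ^ k) r<2 ⟩
  x * 2 % (2 ^ k * 2) + r            ≡⟨ cong (_+ r) (m%n*o≡m*o%[n*o] x (2 ^ k) 2) ⟨
  x % 2 ^ k * 2 + r                  ≡⟨ reorder r (x % 2 ^ k) ⟨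
  r + (x % 2 ^ k + x % 2 ^ k)        ∎
  where
  open ≡-Reasoning
  instance
    _ = m^n≢0 2 k
    _ = m^n≢0 2 (suc k)
    _ = m*n≢0 (2 ^ k) 2
  reorder : ∀ r x → r + (x + x) ≡ x * 2 + r
  reorder = solve-∀

mod2^-double : ∀ k x → (x + x) mod2^ suc k ≡ x mod2^ k + x mod2^ k
mod2^-double k x = mod2^-double-+ k x (s≤s z≤n)

mod2^-double+1 : ∀ k x → suc (x + x) mod2^ suc k ≡ suc (x mod2^ k + x mod2^ k)
mod2^-double+1 k x = mod2^-double-+ k x (s≤s (s≤s z≤n))

mod2^-double-cong : ∀ k {a b} → a mod2^ k ≡ b mod2^ k → (a + a) mod2^ suc k ≡ (b + b) mod2^ suc k
mod2^-double-cong k {a} {b} eq =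
  trans (mod2^-double k a) (trans (cong (λ r → r + r) eq) (sym (mod2^-double k b)))

mod2^-double-injective : ∀ k {a b} → (a + a) mod2^ suc k ≡ (b + b) mod2^ suc k → a mod2^ k ≡ b mod2^ k
mod2^-double-injective k {a} {b} eq =
  n+n-injective (trans (sym (mod2^-double k a)) (trans eq (mod2^-double k b)))

mod2^-even≢odd : ∀ k a b → (a + a) mod2^ suc k ≢ suc (b + b) mod2^ suc k
mod2^-even≢odd k a b eq with
  trans (sym (parity-double (a mod2^ k)))
        (trans (cong parity (trans (sym (mod2^-double k a)) (trans eq (mod2^-double+1 k b))))
               (parity-double+1 (b mod2^ k)))
... | ()

adj-congˡ : ∀ {k x y z} → x mod2^ k ≡ y mod2^ k → Adj k y z → Adj k x z
adj-congˡ eq (y≢z , i , i<k , inj₁ z+2^i≡y) = (y≢z ∘ trans (sym eq)) , i , i<k , inj₁ (trans z+2^i≡y (sym eq))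
adj-congˡ {k} eq (y≢z , i , i<k , inj₂ y+2^i≡z) =
  (y≢z ∘ trans (sym eq)) , i , i<k , inj₂ (trans (mod2^-+-congˡ k (2 ^ i) eq) y+2^i≡z)

adj-double : ∀ {k x z} → Adj k x z → Adj (suc k) (x + x) (z + z)
adj-double {k} {x} {z} (x≢z , i , i<k , edge) =
  (x≢z ∘ mod2^-double-injective k) , suc i , s≤s i<k , ⊎-map double-step double-step edge
  where
  double-step : ∀ {a b} → (a + 2 ^ i) mod2^ k ≡ b mod2^ k → (a + a + 2 ^ suc i) mod2^ suc k ≡ (b + b) mod2^ suc k
  double-step {a} eq = trans (cong (_mod2^ suc k) (m+m+2*n≡[m+n]+[m+n] a (2 ^ i))) (mod2^-double-cong k eq)

adj-double-up : ∀ k m → Adj (suc k) (m + m) (suc (m + m))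
adj-double-up k m =
  mod2^-even≢odd k m m , 0 , s≤s z≤n , inj₂ (cong (_mod2^ suc k) (+-comm (m + m) 1))

adj-double-down : ∀ k m → Adj (suc k) (suc m + suc m) (suc (m + m))
adj-double-down k m =
  mod2^-even≢odd k (suc m) m , 0 , s≤s z≤n ,
  inj₁ (cong (_mod2^ suc k) (trans (+-comm (suc (m + m)) 1) (cong suc (sym (+-suc m m)))))

walk-snoc : ∀ {k x y z n} → Walk k x y n → Adj k y z → Walk k x z (suc n)
walk-snoc (here eq) a  = step (adj-congˡ eq a) (here refl)
walk-snoc (step a w) b = step a (walk-snoc w b)

walk-double : ∀ {k x y n} → Walk k x y n → Walk (suc k) (x + x) (y + y) n
walk-double {k} (here eq) = here (mod2^-double-cong k eq)
walk-double (step a w)    = step (adj-double a) (walk-double w)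

walk-to : ∀ k j → Walk k 0 j (dist k j)
walk-to zero    j = here (sym (n%1≡0 j))
walk-to (suc k) j with half j
... | even m = subst (Walk (suc k) 0 (m + m)) (sym (dist-double k m)) (walk-double (walk-to k m))
... | odd m with ≤-total (dist k m) (dist k (suc m))
...   | inj₁ d≤d′ = subst (Walk (suc k) 0 (suc (m + m)))
                     (trans (cong suc (sym (m≤n⇒m⊓n≡m d≤d′))) (sym (dist-double+1 k m)))
                     (walk-snoc (walk-double (walk-to k m)) (adj-double-up k m))
...   | inj₂ d≥d′ = subst (Walk (suc k) 0 (suc (m + m)))
                     (trans (cong suc (sym (m≥n⇒m⊓n≡n d≥d′))) (sym (dist-double+1 k m)))
                     (walk-snoc (walk-double (walk-to k (suc m))) (adj-double-down k m))

dist-adj : ∀ {k x z} → Adj k x z → dist k z ≤ suc (dist k x)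
dist-adj {k} {x} {z} (_ , i , i<k , inj₁ z+2^i≡x) =
  subst (λ d → dist k z ≤ suc d) (dist-cong k z+2^i≡x) (proj₁ (dist-withinOne-+2^ k i z i<k))
dist-adj {k} {x} {z} (_ , i , i<k , inj₂ x+2^i≡z) =
  subst (_≤ suc (dist k x)) (dist-cong k x+2^i≡z) (proj₂ (dist-withinOne-+2^ k i x i<k))

dist-walk : ∀ {k x y n} → Walk k x y n → dist k y ≤ n + dist k x
dist-walk {k} (here eq) = ≤-reflexive (dist-cong k (sym eq))
dist-walk {k} {x} {n = suc n} (step a w) = begin
  _                ≤⟨ dist-walk w ⟩
  n + _            ≤⟨ +-monoʳ-≤ n (dist-adj a) ⟩
  n + suc (dist k x) ≡⟨ +-suc n (dist k x) ⟩
  suc n + dist k x ∎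
  where open ≤-Reasoning

Dist-dist : ∀ k j → Dist k 0 j (dist k j)
Dist-dist k j = walk-to k j , λ n w →
  subst (dist k j ≤_) (trans (cong (n +_) (dist-zero k)) (+-identityʳ n)) (dist-walk w)

Dist⇒≡dist : ∀ {k j d} → Dist k 0 j d → d ≡ dist k j
Dist⇒≡dist {k} {j} {d} (w , minimal) = ≤-antisym (minimal _ (walk-to k j)) (proj₂ (Dist-dist k j) d w)

-- From Γ_{2^k} to Γ_{2^{k+1}}

Grows : ℕ → ℕ → ℕ → Set
Grows k a j = dist (suc k) j ≡ a + dist k j

Dist-grows : ∀ {k a j d} → Grows k a j → Dist k 0 j d → Dist (suc k) 0 j (a + d)
Dist-grows {k} {a} {j} grows D =
  subst (Dist (suc k) 0 j) (trans grows (cong (a +_) (sym (Dist⇒≡dist D)))) (Dist-dist (suc k) j)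

grows-double : ∀ {k} a m → Grows k a m → Grows (suc k) a (m + m)
grows-double {k} a m grows = trans (dist-double (suc k) m) (trans grows (cong (a +_) (sym (dist-double k m))))

grows-double+1 : ∀ {k} a m → Grows k a m → Grows k a (suc m) → Grows (suc k) a (suc (m + m))
grows-double+1 {k} a m grows grows′ = begin
  dist (suc (suc k)) (suc (m + m))                     ≡⟨ dist-double+1 (suc k) m ⟩
  suc (dist (suc k) m ⊓ dist (suc k) (suc m))          ≡⟨ cong₂ (λ x y → suc (x ⊓ y)) grows grows′ ⟩
  suc ((a + dist k m) ⊓ (a + dist k (suc m)))          ≡⟨ cong suc (+-distribˡ-⊓ a _ _) ⟨
  suc (a + (dist k m ⊓ dist k (suc m)))                ≡⟨ +-suc a _ ⟨
  a + suc (dist k m ⊓ dist k (suc m))                  ≡⟨ cong (a +_) (dist-double+1 k m) ⟨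
  a + dist (suc k) (suc (m + m))                       ∎
  where open ≡-Reasoning

record SplitsAt (k t : ℕ) : Set where
  field
    unchanged : ∀ {j} → j ≤ t → Grows k 0 j
    increased : ∀ {j} → t < j → j ≤ 2 ^ k → Grows k 1 j
open SplitsAt

bit : Parity → ℕ
bit 0ℙ = 0
bit 1ℙ = 1

dist-drop-double : ∀ {k t} p → dist k t ≡ bit p + dist k (suc t) →
  let t′ = bit (p ⁻¹) + (t + t) in dist (suc k) t′ ≡ bit (p ⁻¹) + dist (suc k) (suc t′)
dist-drop-double {k} {t} 0ℙ drop = begin
  dist (suc k) (suc (t + t))            ≡⟨ dist-double+1 k t ⟩
  suc (dist k t ⊓ dist k (suc t))       ≡⟨ cong (λ x → suc (x ⊓ dist k (suc t))) drop ⟩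
  suc (dist k (suc t) ⊓ dist k (suc t)) ≡⟨ cong suc (⊓-idem _) ⟩
  suc (dist k (suc t))                  ≡⟨ cong suc (dist-double+2 k t) ⟨
  suc (dist (suc k) (suc (suc (t + t)))) ∎
  where open ≡-Reasoning
dist-drop-double {k} {t} 1ℙ drop = begin
  dist (suc k) (t + t)                  ≡⟨ dist-double k t ⟩
  dist k t                              ≡⟨ drop ⟩
  suc (dist k (suc t))                  ≡⟨ cong suc (m≥n⇒m⊓n≡n (n≤1+n _)) ⟨
  suc (suc (dist k (suc t)) ⊓ dist k (suc t)) ≡⟨ cong (λ x → suc (x ⊓ dist k (suc t))) drop ⟨
  suc (dist k t ⊓ dist k (suc t))       ≡⟨ dist-double+1 k t ⟨
  dist (suc k) (suc (t + t))            ∎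
  where open ≡-Reasoning

m+m≤2^[1+k]⇒m≤2^k : ∀ {m} k → m + m ≤ 2 ^ suc k → m ≤ 2 ^ k
m+m≤2^[1+k]⇒m≤2^k {m} k le =
  half-≤ (subst (m + m ≤_) (2^[1+k]≡2^k+2^k k) le) (⌊n+n/2⌋≡n m) (⌊n+n/2⌋≡n (2 ^ k))

1+m+m≤2^[1+k]⇒m<2^k : ∀ {m} k → suc (m + m) ≤ 2 ^ suc k → m < 2 ^ k
1+m+m≤2^[1+k]⇒m<2^k {m} k le =
  half-≤ (s≤s (subst (suc (m + m) ≤_) (2^[1+k]≡2^k+2^k k) le)) (cong suc (⌊n+n/2⌋≡n m)) (⌊1+n+n/2⌋≡n (2 ^ k))

dist-straddle : ∀ {k t} → SplitsAt k t → t < 2 ^ k →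
                dist (suc (suc k)) (suc (t + t)) ≡ suc (dist k t ⊓ suc (dist k (suc t)))
dist-straddle {k} {t} s t<2^k =
  trans (dist-double+1 (suc k) t) (cong₂ (λ x y → suc (x ⊓ y)) (unchanged s ≤-refl) (increased s ≤-refl t<2^k))

splitsAt-1+2t : ∀ {k t} → t < 2 ^ k → dist k t ≡ dist k (suc t) → SplitsAt k t → SplitsAt (suc k) (suc (t + t))
unchanged (splitsAt-1+2t {k} {t} t<2^k drop s) {J} J≤t′ with half J
... | even m = grows-double 0 m (unchanged s (half-≤ J≤t′ (⌊n+n/2⌋≡n m) (⌊1+n+n/2⌋≡n t)))
... | odd m with m≤n⇒m<n∨m≡n (half-≤ (s≤s⁻¹ J≤t′) (⌊n+n/2⌋≡n m) (⌊n+n/2⌋≡n t))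
...   | inj₁ m<t = grows-double+1 0 m (unchanged s (<⇒≤ m<t)) (unchanged s m<t)
...   | inj₂ refl = begin
  dist (suc (suc k)) (suc (t + t))           ≡⟨ dist-straddle s t<2^k ⟩
  suc (dist k t ⊓ suc (dist k (suc t)))      ≡⟨ cong (λ x → suc (x ⊓ suc (dist k (suc t)))) drop ⟩
  suc (dist k (suc t) ⊓ suc (dist k (suc t))) ≡⟨ cong suc (m≤n⇒m⊓n≡m (n≤1+n _)) ⟩
  suc (dist k (suc t))                       ≡⟨ cong suc (⊓-idem _) ⟨
  suc (dist k (suc t) ⊓ dist k (suc t))      ≡⟨ cong (λ x → suc (x ⊓ dist k (suc t))) drop ⟨
  suc (dist k t ⊓ dist k (suc t))            ≡⟨ dist-double+1 k t ⟨
  dist (suc k) (suc (t + t))                 ∎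
  where open ≡-Reasoning
increased (splitsAt-1+2t {k} {t} t<2^k drop s) {J} t′<J J≤2^k with half J
... | even m = grows-double 1 m (increased s (half-≤ t′<J (cong suc (⌊n+n/2⌋≡n t)) (⌊n+n/2⌋≡n m))
                                            (m+m≤2^[1+k]⇒m≤2^k k J≤2^k))
... | odd m = grows-double+1 1 m (increased s t<m (<⇒≤ (1+m+m≤2^[1+k]⇒m<2^k k J≤2^k)))
                                 (increased s (m<n⇒m<1+n t<m) (1+m+m≤2^[1+k]⇒m<2^k k J≤2^k))
  where
  t<m : t < m
  t<m = half-≤ t′<J (cong suc (⌊n+n/2⌋≡n t)) (⌊1+n+n/2⌋≡n m)

splitsAt-2t : ∀ {k t} → t < 2 ^ k → dist k t ≡ suc (dist k (suc t)) → SplitsAt k t → SplitsAt (suc k) (t + t)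
unchanged (splitsAt-2t {k} {t} t<2^k drop s) {J} J≤t′ with half J
... | even m = grows-double 0 m (unchanged s (half-≤ J≤t′ (⌊n+n/2⌋≡n m) (⌊n+n/2⌋≡n t)))
... | odd m = grows-double+1 0 m (unchanged s (<⇒≤ m<t)) (unchanged s m<t)
  where
  m<t : m < t
  m<t = half-≤ (s≤s J≤t′) (cong suc (⌊n+n/2⌋≡n m)) (⌊1+n+n/2⌋≡n t)
increased (splitsAt-2t {k} {t} t<2^k drop s) {J} t′<J J≤2^k with half J
... | even m = grows-double 1 m (increased s (half-≤ (s≤s t′<J) (cong suc (⌊n+n/2⌋≡n t)) (⌊1+n+n/2⌋≡n m))
                                            (m+m≤2^[1+k]⇒m≤2^k k J≤2^k))
... | odd m with m≤n⇒m<n∨m≡n (half-≤ t′<J (⌊1+n+n/2⌋≡n t) (⌊1+n+n/2⌋≡n m))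
...   | inj₁ t<m = grows-double+1 1 m (increased s t<m (<⇒≤ (1+m+m≤2^[1+k]⇒m<2^k k J≤2^k)))
                                      (increased s (m<n⇒m<1+n t<m) (1+m+m≤2^[1+k]⇒m<2^k k J≤2^k))
...   | inj₂ refl = begin
  dist (suc (suc k)) (suc (t + t))                  ≡⟨ dist-straddle s t<2^k ⟩
  suc (dist k t ⊓ suc (dist k (suc t)))             ≡⟨ cong (λ x → suc (x ⊓ suc (dist k (suc t)))) drop ⟩
  suc (suc (dist k (suc t) ⊓ dist k (suc t)))       ≡⟨ cong (suc ∘ suc) (⊓-idem _) ⟩
  suc (suc (dist k (suc t)))                        ≡⟨ cong (suc ∘ suc) (m≥n⇒m⊓n≡n (n≤1+n _)) ⟨
  suc (suc (suc (dist k (suc t)) ⊓ dist k (suc t))) ≡⟨ cong (λ x → suc (suc (x ⊓ dist k (suc t)))) drop ⟨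
  suc (suc (dist k t ⊓ dist k (suc t)))             ≡⟨ cong suc (dist-double+1 k t) ⟨
  suc (dist (suc k) (suc (t + t)))                  ∎
  where open ≡-Reasoning

splitsAt-double : ∀ {k t} p → t < 2 ^ k → dist k t ≡ bit p + dist k (suc t) →
                  SplitsAt k t → SplitsAt (suc k) (bit (p ⁻¹) + (t + t))
splitsAt-double 0ℙ = splitsAt-1+2t
splitsAt-double 1ℙ = splitsAt-2t

-- The threshold

threshold : ℕ → ℕ
threshold zero    = 0
threshold (suc h) = bit (parity h) + (threshold h + threshold h)

threshold<2^ : ∀ k → threshold (suc k) < 2 ^ k
threshold<2^ zero    = s≤s z≤n
threshold<2^ (suc k) = begin-strict
  bit (parity (suc k)) + (t + t) ≤⟨ +-monoˡ-≤ (t + t) (bit≤1 (parity (suc k))) ⟩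
  suc (t + t)                    <⟨ s≤s (≤-reflexive (sym (+-suc t t))) ⟩
  suc t + suc t                  ≤⟨ +-mono-≤ (threshold<2^ k) (threshold<2^ k) ⟩
  2 ^ k + 2 ^ k                  ≡⟨ 2^[1+k]≡2^k+2^k k ⟨
  2 ^ suc k                      ∎
  where
  open ≤-Reasoning
  t = threshold (suc k)
  bit≤1 : ∀ p → bit p ≤ 1
  bit≤1 0ℙ = z≤n
  bit≤1 1ℙ = s≤s z≤n

threshold-suc-suc : ∀ k → threshold (suc (suc k)) ≡ bit (parity k ⁻¹) + (threshold (suc k) + threshold (suc k))
threshold-suc-suc k = cong (λ p → bit p + (threshold (suc k) + threshold (suc k))) (parity-suc k)

dist-drop-threshold : ∀ k → dist k (threshold (suc k)) ≡ bit (parity k) + dist k (suc (threshold (suc k)))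
dist-drop-threshold zero    = refl
dist-drop-threshold (suc k) =
  subst (λ p → let t′ = bit p + (t + t) in dist (suc k) t′ ≡ bit p + dist (suc k) (suc t′))
        (sym (parity-suc k)) (dist-drop-double (parity k) (dist-drop-threshold k))
  where t = threshold (suc k)

splitsAt-threshold : ∀ k → SplitsAt k (threshold (suc k))
splitsAt-threshold zero = record { unchanged = unchanged₀ ; increased = increased₀ }
  where
  unchanged₀ : ∀ {j} → j ≤ 0 → Grows 0 0 j
  unchanged₀ z≤n = refl
  increased₀ : ∀ {j} → 0 < j → j ≤ 1 → Grows 0 1 j
  increased₀ (s≤s z≤n) (s≤s z≤n) = refl
splitsAt-threshold (suc k) =
  subst (SplitsAt (suc k)) (sym (threshold-suc-suc k))
        (splitsAt-double (parity k) (threshold<2^ k) (dist-drop-threshold k) (splitsAt-threshold k))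

threshold-2* : ∀ n → threshold (2 * n) ≡ (4 ^ n ∸ 1) / 3
threshold-2* n = begin
  threshold (2 * n)                    ≡⟨ m*n/n≡m (threshold (2 * n)) 3 ⟨
  threshold (2 * n) * 3 / 3            ≡⟨ cong (_/ 3) (m+n∸n≡m (threshold (2 * n) * 3) 1) ⟨
  (threshold (2 * n) * 3 + 1 ∸ 1) / 3  ≡⟨ cong (λ x → (x ∸ 1) / 3) (closed-form n) ⟩
  (4 ^ n ∸ 1) / 3                      ∎
  where
  open ≡-Reasoning
  closed-form : ∀ n → threshold (2 * n) * 3 + 1 ≡ 4 ^ n
  closed-form zero    = refl
  closed-form (suc n) = begin
    threshold (2 * suc n) * 3 + 1      ≡⟨ cong (λ h → threshold h * 3 + 1) (*-suc 2 n) ⟩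
    threshold (suc (suc (2 * n))) * 3 + 1
      ≡⟨ cong (λ x → x * 3 + 1) (threshold-suc-suc (2 * n)) ⟩
    (bit (parity (2 * n) ⁻¹) + (threshold (suc (2 * n)) + threshold (suc (2 * n)))) * 3 + 1
      ≡⟨ cong (λ p → (bit (p ⁻¹) + (bit p + (A + A) + (bit p + (A + A)))) * 3 + 1) (*-homo-* 2 n) ⟩
    suc ((A + A) + (A + A)) * 3 + 1    ≡⟨ regroup A ⟩
    4 * (A * 3 + 1)                    ≡⟨ cong (4 *_) (closed-form n) ⟩
    4 ^ suc n                          ∎
    where
    A = threshold (2 * n)
    regroup : ∀ A → suc ((A + A) + (A + A)) * 3 + 1 ≡ 4 * (A * 3 + 1)
    regroup = solve-∀

threshold-1+2* : ∀ n → threshold (2 * n + 1) ≡ 2 * ((4 ^ n ∸ 1) / 3)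
threshold-1+2* n = begin
  threshold (2 * n + 1)               ≡⟨ cong threshold (+-comm (2 * n) 1) ⟩
  bit (parity (2 * n)) + (A + A)      ≡⟨ cong (λ p → bit p + (A + A)) (*-homo-* 2 n) ⟩
  A + A                               ≡⟨ cong (λ x → x + x) (threshold-2* n) ⟩
  (4 ^ n ∸ 1) / 3 + (4 ^ n ∸ 1) / 3   ≡⟨ cong ((4 ^ n ∸ 1) / 3 +_) (+-identityʳ _) ⟨
  2 * ((4 ^ n ∸ 1) / 3)               ∎
  where
  open ≡-Reasoning
  A = threshold (2 * n)

Dist-splitsAt : ∀ {k t} → SplitsAt k t →
  ((j d : ℕ) → j ≤ t → Dist k 0 j d → Dist (suc k) 0 j d)
  × ((j d : ℕ) → t < j → j ≤ 2 ^ k → Dist k 0 j d → Dist (suc k) 0 j (suc d))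
Dist-splitsAt s = (λ j d j≤t → Dist-grows (unchanged s j≤t))
                , (λ j d t<j j≤2^k → Dist-grows (increased s t<j j≤2^k))

theorem3p6 : (h : ℕ) → 1 ≤ h →
    ((n : ℕ) → h ≡ 2 * n →
      ((j d : ℕ) → j ≤ (4 ^ n ∸ 1) / 3 → Dist (h ∸ 1) 0 j d → Dist h 0 j d)
      × ((j d : ℕ) → (4 ^ n ∸ 1) / 3 < j → j ≤ 2 ^ (h ∸ 1) →
          Dist (h ∸ 1) 0 j d → Dist h 0 j (suc d)))
    × ((n : ℕ) → h ≡ 2 * n + 1 →
      ((j d : ℕ) → j ≤ 2 * ((4 ^ n ∸ 1) / 3) → Dist (h ∸ 1) 0 j d → Dist h 0 j d)
      × ((j d : ℕ) → 2 * ((4 ^ n ∸ 1) / 3) < j → j ≤ 2 ^ (h ∸ 1) →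
          Dist (h ∸ 1) 0 j d → Dist h 0 j (suc d)))
theorem3p6 zero    ()
theorem3p6 (suc k) _ =
    (λ n h≡2n → Dist-splitsAt (split-at (trans (cong threshold h≡2n) (threshold-2* n))))
  , (λ n h≡2n+1 → Dist-splitsAt (split-at (trans (cong threshold h≡2n+1) (threshold-1+2* n))))
  where
  split-at : ∀ {t} → threshold (suc k) ≡ t → SplitsAt k t
  split-at eq = subst (SplitsAt k) eq (splitsAt-threshold k)
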